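{- For every positive integer $N$, \[ \sum_{\substack{\pi\in\mathcal{U}\\ |\pi|=N}} (-1)^{s(\pi)+1} \;=\; \sum_{\substack{\pi\in\mathcal{U}^*\\ |\pi|=N}} t(\pi). \] Equivalently, as formal power series in $q$: $\sum_{\pi\in\mathcal{U}} (-1)^{s(\pi)+1} q^{|\pi|} = \sum_{\pi\in\mathcal{U}^*} t(\pi) q^{|\pi|}$.
   Context: A partition is a finite non-increasing sequence of positive integers (its parts); $|\pi|$ is the sum of its parts and $s(\pi)$ its smallest part. For a positive integer $i$, $f_i=f_i(\pi)$ denotes the number of times $i$ occurs as a part of $\pi$ (possibly $0$). $\mathcal{U}$ is the set of all non-empty partitions, and $\mathcal{U}^*\subseteq\mathcal{U}$ is the subset of partitions with $f_1(\pi)$ odd. For a partition $\pi$, $t(\pi)$ is the non-negative integer such that $f_i(\pi)$ is odd for all $1\le i\le t(\pi)$ and $f_{t(\pi)+1}(\pi)$ is even (possibly zero). -}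

module Defs where

open import Data.Nat using (ℕ; zero; suc; _+_; _≥_; _<_; _%_; _⊓_)
open import Data.Nat.Properties using (_≟_)
open import Data.Integer as ℤ using (ℤ; -1ℤ; 0ℤ)
open import Data.List using (List; []; _∷_; filter; length; map; foldr)
open import Data.Nat.ListAction using (sum)
open import Data.List.Relation.Unary.All using (All)
open import Data.List.Relation.Unary.Linked using (Linked)
open import Relation.Binary.PropositionalEquality using (_≡_; _≢_)
open import Relation.Nullary using (Dec; yes; no)
open import Data.Product using (_×_)

-- A partition is a list of parts, written in non-increasing order,
-- all parts positive.  IsPartition also demands non-emptiness (the set 𝒰).
IsPartition : List ℕ → Set
IsPartition π = Linked _≥_ π × All (0 <_) π × π ≢ []

size : List ℕ → ℕ
size = sum

-- s(π): smallest part (for the empty list we return 0; irrelevant for 𝒰)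
smallest : List ℕ → ℕ
smallest []           = 0
smallest (x ∷ [])     = x
smallest (x ∷ y ∷ xs) = x ⊓ smallest (y ∷ xs)

mult : ℕ → List ℕ → ℕ
mult i π = length (filter (i ≟_) π)

Odd : ℕ → Set
Odd n = n % 2 ≡ 1

odd? : (n : ℕ) → Dec (Odd n)
odd? n = (n % 2) ≟ 1

tFrom : ℕ → ℕ → List ℕ → ℕ
tFrom zero    i π = 0
tFrom (suc k) i π with odd? (mult i π)
... | yes _ = suc (tFrom k (suc i) π)
... | no  _ = 0

-- t(π): the largest t with f_1,...,f_t all odd (so f_{t+1} even).
-- Since f_j(π) = 0 for j > |π|, the search bound |π| + 1 is never reached
-- prematurely: t(π) ≤ |π|.
t : List ℕ → ℕ
t π = tFrom (suc (size π)) 1 π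

sumℤ : List ℤ → ℤ
sumℤ = foldr ℤ._+_ 0ℤ

sign : List ℕ → ℤ
sign π = -1ℤ ℤ.^ (smallest π + 1)

{-# OPTIONS --safe #-}
module Submission where

-- Let t_k(π) be the number of consecutive odd multiplicities f_k, f_{k+1}, … of π, so t = t_1,
-- and let B_k(M) = Σ_{π ⊢ M} t_k(π).  Inserting a part k is a bijection from the partitions of M
-- onto the partitions of M + k that contain k; it flips the parity of f_k and keeps every f_j
-- with j > k, so t_k(π ∪ {k}) + t_k(π) = 1 + t_{k+1}(π).  Hence
--   B_k(M + k) + B_k(M) = p(M) + B_{k+1}(M)   and   B_k(M) = 0 for M < k,
-- a recurrence that determines B_k.  Let q_j(r) count the partitions of r into parts greater
-- than j.  Removing one part j + 1 gives q_j(r) − q_{j+1}(r) = q_j(r − j − 1), and with this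
-- A_k(M) = Σ_{j ≥ 0} (−1)^j q_j(M − k(j + 1)) satisfies the same recurrence, so A_1 = B_1.
-- Grouping the partitions of N by their smallest part j + 1 shows that the left-hand side is A_1(N).

open import Defs
open import Data.Nat using (ℕ; _≤_)
open import Data.Integer using (ℤ; +_)
open import Data.List using (List; map; filter)
open import Data.Nat.ListAction using (sum)
open import Data.List.Membership.Propositional using (_∈_)
open import Data.List.Relation.Unary.Unique.Propositional using (Unique)
open import Data.Product using (_×_; _,_)
open import Data.Nat.Properties using (<⇒≢)
open import Function using (_∘_)
open import Function.Bundles using (_⇔_; mk⇔; Equivalence)
open import Relation.Binary.PropositionalEquality using (_≡_; refl; sym; cong; module ≡-Reasoning)
open import Relation.Nullary using (Dec)

module ListSums where

  open import Data.Integer using (0ℤ; _+_; _*_)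
  import Data.Integer.Properties as ℤ
  open import Data.List using ([]; _∷_; _++_)
  open import Data.List.Properties using (map-∘; map-cong-local)
  open import Data.List.Relation.Unary.All using (tabulate)
  open import Data.List.Relation.Unary.Any using (here; there)
  open import Data.List.Relation.Binary.Permutation.Propositional using (_↭_; ↭⇒↭ₛ)
  open import Data.List.Relation.Binary.Permutation.Propositional.Properties using (map⁺)
  import Data.List.Relation.Binary.Permutation.Setoid.Properties as ↭ₛ
  open import Algebra.Properties.CommutativeSemigroup ℤ.+-commutativeSemigroup using (interchange)
  open import Relation.Binary.PropositionalEquality using (trans; cong₂; setoid)
  open import Relation.Nullary using (¬_; yes; no)
  open import Relation.Unary using (Pred; Decidable)
  open import Level using (0ℓ)

  sumℤ-↭ : ∀ {xs ys} → xs ↭ ys → sumℤ xs ≡ sumℤ ys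
  sumℤ-↭ p = ↭ₛ.foldr-commMonoid (setoid ℤ) ℤ.+-0-isCommutativeMonoid (↭⇒↭ₛ p)

  sumBy : {A : Set} → (A → ℤ) → List A → ℤ
  sumBy w xs = sumℤ (map w xs)

  module _ {A : Set} where

    sumBy-↭ : (w : A → ℤ) {xs ys : List A} → xs ↭ ys → sumBy w xs ≡ sumBy w ys
    sumBy-↭ w p = sumℤ-↭ (map⁺ w p)

    sumBy-++ : (w : A → ℤ) (xs ys : List A) → sumBy w (xs ++ ys) ≡ sumBy w xs + sumBy w ys
    sumBy-++ w []       ys = sym (ℤ.+-identityˡ _)
    sumBy-++ w (x ∷ xs) ys = trans (cong (_+_ (w x)) (sumBy-++ w xs ys)) (sym (ℤ.+-assoc (w x) _ _))

    sumBy-map : {B : Set} (w : B → ℤ) (f : A → B) (xs : List A) → sumBy w (map f xs) ≡ sumBy (w ∘ f) xs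
    sumBy-map w f xs = cong sumℤ (sym (map-∘ xs))

    sumBy-cong : {w v : A → ℤ} (xs : List A) → (∀ {x} → x ∈ xs → w x ≡ v x) → sumBy w xs ≡ sumBy v xs
    sumBy-cong xs w≗v = cong sumℤ (map-cong-local (tabulate w≗v))

    sumBy-zero : (w : A → ℤ) {xs : List A} → (∀ {x} → x ∈ xs → w x ≡ 0ℤ) → sumBy w xs ≡ 0ℤ
    sumBy-zero w {[]}     w≡0 = refl
    sumBy-zero w {x ∷ xs} w≡0 = cong₂ _+_ (w≡0 (here refl)) (sumBy-zero w (w≡0 ∘ there))

    sumBy-+ : (w v : A → ℤ) (xs : List A) → sumBy (λ x → w x + v x) xs ≡ sumBy w xs + sumBy v xs
    sumBy-+ w v []       = refl
    sumBy-+ w v (x ∷ xs) = trans (cong (_+_ (w x + v x)) (sumBy-+ w v xs))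
                                 (interchange (w x) (v x) (sumBy w xs) (sumBy v xs))

    sumBy-*ˡ : (c : ℤ) (w : A → ℤ) (xs : List A) → sumBy (λ x → c * w x) xs ≡ c * sumBy w xs
    sumBy-*ˡ c w []       = sym (ℤ.*-zeroʳ c)
    sumBy-*ˡ c w (x ∷ xs) = trans (cong (_+_ (c * w x)) (sumBy-*ˡ c w xs)) (sym (ℤ.*-distribˡ-+ c (w x) _))

    sumBy-filter : {P : Pred A 0ℓ} (P? : Decidable P) (w : A → ℤ) (xs : List A) →
                   (∀ {x} → ¬ P x → w x ≡ 0ℤ) → sumBy w (filter P? xs) ≡ sumBy w xs
    sumBy-filter P? w []       w≡0 = refl
    sumBy-filter P? w (x ∷ xs) w≡0 with P? x
    ... | yes _  = cong (_+_ (w x)) (sumBy-filter P? w xs w≡0)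
    ... | no ¬px = trans (sumBy-filter P? w xs w≡0)
                         (sym (trans (cong (_+ sumBy w xs) (w≡0 ¬px)) (ℤ.+-identityˡ _)))

    pos-sum-map : (f : A → ℕ) (xs : List A) → + sum (map f xs) ≡ sumBy (+_ ∘ f) xs
    pos-sum-map f []       = refl
    pos-sum-map f (x ∷ xs) = trans (ℤ.pos-+ (f x) _) (cong (_+_ (+ f x)) (pos-sum-map f xs))

module Enumerations where

  open import Data.List using ([]; _∷_; _++_)
  open import Data.List.Membership.Propositional.Properties
    using (∈-map⁺; ∈-map⁻; ∈-++⁺ˡ; ∈-++⁺ʳ; ∈-++⁻; ∈-filter⁺; ∈-filter⁻)
  open import Data.List.Membership.Propositional.Properties.WithK using (unique∧set⇒bag)
  open import Data.List.Relation.Binary.BagAndSetEquality using (∼bag⇒↭)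
  open import Data.List.Relation.Binary.Permutation.Propositional using (_↭_)
  open import Data.List.Relation.Unary.Any using (here)
  open import Data.Empty using (⊥-elim)
  import Data.List.Relation.Unary.Unique.Propositional.Properties as Unique
  open import Data.List.Relation.Unary.AllPairs using ([]; _∷_)
  open import Data.List.Relation.Unary.All using ([])
  open import Data.Product using (∃-syntax)
  open import Data.Sum using (_⊎_; inj₁; inj₂; [_,_])
  open import Level using (0ℓ)
  open import Relation.Binary.PropositionalEquality using (subst)
  open import Relation.Nullary using (¬_)
  open import Relation.Unary using (Pred; Decidable)
  open Equivalence using (to; from)

  Enumerates : {A : Set} → Pred A 0ℓ → List A → Set
  Enumerates P xs = Unique xs × (∀ x → x ∈ xs ⇔ P x)

  module _ {A : Set} {P : Pred A 0ℓ} where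

    enumerates-↭ : ∀ {xs ys} → Enumerates P xs → Enumerates P ys → xs ↭ ys
    enumerates-↭ (!xs , xs⇔P) (!ys , ys⇔P) = ∼bag⇒↭ (unique∧set⇒bag !xs !ys λ {z} →
      mk⇔ (from (ys⇔P z) ∘ to (xs⇔P z)) (from (xs⇔P z) ∘ to (ys⇔P z)))

    enumerates-[] : (∀ x → ¬ P x) → Enumerates P []
    enumerates-[] ¬P = [] , λ x → mk⇔ (λ ()) (⊥-elim ∘ ¬P x)

    enumerates-[-] : ∀ {x} → P x → (∀ {y} → P y → y ≡ x) → Enumerates P (x ∷ [])
    enumerates-[-] px P⇒≡x = [] ∷ [] , λ y → mk⇔ (λ { (here refl) → px }) (here ∘ P⇒≡x)

    enumerates-resp : ∀ {Q : Pred A 0ℓ} {xs} → (∀ x → P x ⇔ Q x) → Enumerates P xs → Enumerates Q xs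
    enumerates-resp P⇔Q (!xs , xs⇔P) =
      !xs , λ x → mk⇔ (to (P⇔Q x) ∘ to (xs⇔P x)) (from (xs⇔P x) ∘ from (P⇔Q x))

    enumerates-++ : ∀ {Q : Pred A 0ℓ} {xs ys} → Enumerates P xs → Enumerates Q ys →
                    (∀ {x} → P x → ¬ Q x) → Enumerates (λ x → P x ⊎ Q x) (xs ++ ys)
    enumerates-++ {xs = xs} (!xs , xs⇔P) (!ys , ys⇔Q) P⇒¬Q =
      Unique.++⁺ !xs !ys (λ (x∈xs , x∈ys) → P⇒¬Q (to (xs⇔P _) x∈xs) (to (ys⇔Q _) x∈ys)) ,
      λ x → mk⇔ (λ x∈ → [ inj₁ ∘ to (xs⇔P x) , inj₂ ∘ to (ys⇔Q x) ] (∈-++⁻ xs x∈))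
                [ ∈-++⁺ˡ ∘ from (xs⇔P x) , ∈-++⁺ʳ xs ∘ from (ys⇔Q x) ]

    enumerates-filter : ∀ {Q : Pred A 0ℓ} {xs} (Q? : Decidable Q) → Enumerates P xs →
                        Enumerates (λ x → P x × Q x) (filter Q? xs)
    enumerates-filter Q? (!xs , xs⇔P) =
      Unique.filter⁺ Q? !xs ,
      λ x → mk⇔ (λ x∈ → let x∈xs , qx = ∈-filter⁻ Q? x∈ in to (xs⇔P x) x∈xs , qx)
                (λ (px , qx) → ∈-filter⁺ Q? (from (xs⇔P x) px) qx)

  module _ {A B : Set} {P : Pred A 0ℓ} where

    enumerates-map : ∀ {xs} (f : A → B) → (∀ {x y} → f x ≡ f y → x ≡ y) → Enumerates P xs →
                     Enumerates (λ y → ∃[ x ] P x × f x ≡ y) (map f xs)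
    enumerates-map f f-inj (!xs , xs⇔P) =
      Unique.map⁺ f-inj !xs ,
      λ y → mk⇔ (λ y∈ → let x , x∈xs , y≡fx = ∈-map⁻ f y∈ in x , to (xs⇔P x) x∈xs , sym y≡fx)
                (λ (x , px , fx≡y) → subst (_∈ map f _) fx≡y (∈-map⁺ f (from (xs⇔P x) px)))
module Partitions where

  open import Data.Nat using (zero; suc; _+_; _<_; _≥_; _⊓_; z≤n; s≤s; _≤ᵇ_)
  open import Data.Nat.Properties
  open import Data.Bool using (true; false; T)
  open import Data.Empty using (⊥-elim)
  open import Data.List using ([]; _∷_; _++_; [_]; length)
  open import Data.List.Properties
    using (∷-injectiveˡ; ∷-injectiveʳ; filter-accept; filter-reject; filter-none)
  open import Data.List.Membership.Propositional using (_∉_)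
  open import Data.List.Membership.Propositional.Properties using (∈-∃++)
  open import Data.List.Membership.DecPropositional _≟_ using (_∈?_)
  open import Data.List.Relation.Binary.Permutation.Propositional
    using (_↭_; ↭-sym; ↭-trans; ↭-prep; ↭⇒↭ₛ)
  open import Data.List.Relation.Binary.Permutation.Propositional.Properties
    using (↭-length; filter-↭; shift; All-resp-↭; ∈-resp-↭)
  open import Data.List.Relation.Binary.Pointwise using (Pointwise-≡⇒≡)
  open import Data.List.Relation.Unary.All
    using (All; []; _∷_; tail; zipWith) renaming (lookup to All-lookup; map to All-map)
  open import Data.List.Relation.Unary.All.Properties using (¬Any⇒All¬)
  open import Data.List.Relation.Unary.Any using (here; there)
  open import Data.List.Relation.Unary.Linked using (Linked; [])
  open import Data.List.Relation.Unary.Sorted.TotalOrder.Properties using (↗↭↗⇒≋)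
  open import Relation.Binary.Properties.DecTotalOrder ≤-decTotalOrder using (≥-decTotalOrder)
  open import Data.List.Sort.InsertionSort.Base ≥-decTotalOrder public using (insert)
  open import Data.List.Sort.InsertionSort.Base ≥-decTotalOrder using (sort)
  open import Data.List.Sort.InsertionSort.Properties ≥-decTotalOrder
    using (insert-↭; insert-↗; sort-↭; sort-↗)
  open import Data.Nat.ListAction.Properties using (sum-↭)
  open import Data.Product using (∃-syntax)
  open import Data.Sum using (_⊎_; inj₁; inj₂)
  open import Relation.Binary.Bundles using (DecTotalOrder)
  open import Relation.Binary.PropositionalEquality using (_≢_; trans; cong₂; subst)
  open import Relation.Nullary using (¬_; yes; no)
  open Enumerations

  Odd⇒¬Odd-suc : ∀ n → Odd n → ¬ Odd (suc n)
  Odd⇒¬Odd-suc (suc zero)    _ ()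
  Odd⇒¬Odd-suc (suc (suc n)) o = Odd⇒¬Odd-suc n o

  ¬Odd⇒Odd-suc : ∀ n → ¬ Odd n → Odd (suc n)
  ¬Odd⇒Odd-suc zero          _  = refl
  ¬Odd⇒Odd-suc (suc zero)    ¬o = ⊥-elim (¬o refl)
  ¬Odd⇒Odd-suc (suc (suc n)) ¬o = ¬Odd⇒Odd-suc n ¬o

  mult-↭ : ∀ j {xs ys} → xs ↭ ys → mult j xs ≡ mult j ys
  mult-↭ j xs↭ys = ↭-length (filter-↭ (j ≟_) xs↭ys)

  mult-∉ : ∀ {j xs} → j ∉ xs → mult j xs ≡ 0
  mult-∉ {j} {xs} j∉xs = cong length (filter-none (j ≟_) (¬Any⇒All¬ xs j∉xs))

  mult-insert-self : ∀ k xs → mult k (insert k xs) ≡ suc (mult k xs)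
  mult-insert-self k xs = trans (mult-↭ k (insert-↭ k xs)) (cong length (filter-accept (k ≟_) refl))

  mult-insert-other : ∀ {j k} xs → j ≢ k → mult j (insert k xs) ≡ mult j xs
  mult-insert-other {j} {k} xs j≢k =
    trans (mult-↭ j (insert-↭ k xs)) (cong length (filter-reject (j ≟_) j≢k))

  ∈⇒≤size : ∀ {x xs} → x ∈ xs → x ≤ size xs
  ∈⇒≤size {xs = y ∷ ys} (here refl) = m≤m+n y (size ys)
  ∈⇒≤size {xs = y ∷ ys} (there x∈)  = ≤-trans (∈⇒≤size x∈) (m≤n+m (size ys) y)

  ¬Odd-mult-beyond : ∀ {i xs} → size xs < i → ¬ Odd (mult i xs)
  ¬Odd-mult-beyond {i} {xs} |xs|<i
    rewrite mult-∉ {i} {xs} (λ i∈ → <⇒≱ |xs|<i (∈⇒≤size i∈)) = λ ()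

  tFrom-even : ∀ F i xs → ¬ Odd (mult i xs) → tFrom F i xs ≡ 0
  tFrom-even zero    i xs _   = refl
  tFrom-even (suc F) i xs ¬o with odd? (mult i xs)
  ... | yes o = ⊥-elim (¬o o)
  ... | no _  = refl

  tFrom-cong : ∀ F G i {xs ys} → (∀ j → i ≤ j → mult j xs ≡ mult j ys) →
               size xs < F + i → size ys < G + i → tFrom F i xs ≡ tFrom G i ys
  tFrom-cong zero G i {xs} {ys} xs≈ys xs< _ =
    sym (tFrom-even G i ys (subst (¬_ ∘ Odd) (xs≈ys i ≤-refl) (¬Odd-mult-beyond {i} {xs} xs<)))
  tFrom-cong (suc F) zero i {xs} {ys} xs≈ys _ ys< =
    tFrom-even (suc F) i xs (subst (¬_ ∘ Odd) (sym (xs≈ys i ≤-refl)) (¬Odd-mult-beyond {i} {ys} ys<))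
  tFrom-cong (suc F) (suc G) i {xs} {ys} xs≈ys xs< ys< with odd? (mult i xs) | odd? (mult i ys)
  ... | yes _  | yes _  = cong suc (tFrom-cong F G (suc i) (λ j → xs≈ys j ∘ <⇒≤)
                            (subst (size xs <_) (sym (+-suc F i)) xs<)
                            (subst (size ys <_) (sym (+-suc G i)) ys<))
  ... | yes o  | no ¬o  = ⊥-elim (¬o (subst Odd (xs≈ys i ≤-refl) o))
  ... | no ¬o  | yes o  = ⊥-elim (¬o (subst Odd (sym (xs≈ys i ≤-refl)) o))
  ... | no _   | no _   = refl

  run : ℕ → List ℕ → ℕ
  run k xs = tFrom (suc (size xs)) k xs

  run-even : ∀ k xs → ¬ Odd (mult k xs) → run k xs ≡ 0
  run-even k xs = tFrom-even (suc (size xs)) k xs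

  run-∉ : ∀ {k xs} → k ∉ xs → run k xs ≡ 0
  run-∉ {k} {xs} k∉xs = run-even k xs (subst (¬_ ∘ Odd) (sym (mult-∉ k∉xs)) λ ())

  run-odd : ∀ k xs → Odd (mult k xs) → run k xs ≡ suc (run (suc k) xs)
  run-odd k xs o with odd? (mult k xs)
  ... | yes _ = cong suc (tFrom-cong (size xs) (suc (size xs)) (suc k) (λ _ _ → refl)
                  (m<m+n (size xs) (s≤s z≤n)) (s≤s (m≤m+n (size xs) (suc k))))
  ... | no ¬o = ⊥-elim (¬o o)

  run-insert-above : ∀ k xs → run (suc k) (insert k xs) ≡ run (suc k) xs
  run-insert-above k xs = tFrom-cong _ _ (suc k)
    (λ _ k<j → mult-insert-other xs (λ { refl → <-irrefl refl k<j }))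
    (s≤s (m≤m+n (size (insert k xs)) (suc k))) (s≤s (m≤m+n (size xs) (suc k)))

  run-insert : ∀ k xs → run k (insert k xs) + run k xs ≡ suc (run (suc k) xs)
  run-insert k xs = by-parity (odd? (mult k xs))
    where
    open ≡-Reasoning
    by-parity : Dec (Odd (mult k xs)) → run k (insert k xs) + run k xs ≡ suc (run (suc k) xs)
    by-parity (yes o) = cong₂ _+_ (run-even k (insert k xs) even-after) (run-odd k xs o)
      where
      even-after : ¬ Odd (mult k (insert k xs))
      even-after = subst (¬_ ∘ Odd) (sym (mult-insert-self k xs)) (Odd⇒¬Odd-suc (mult k xs) o)
    by-parity (no ¬o) = begin
      run k (insert k xs) + run k xs       ≡⟨ cong₂ _+_ (run-odd k (insert k xs) odd-after) (run-even k xs ¬o) ⟩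
      suc (run (suc k) (insert k xs)) + 0  ≡⟨ +-identityʳ _ ⟩
      suc (run (suc k) (insert k xs))      ≡⟨ cong suc (run-insert-above k xs) ⟩
      suc (run (suc k) xs)                 ∎
      where
      odd-after : Odd (mult k (insert k xs))
      odd-after = subst Odd (sym (mult-insert-self k xs)) (¬Odd⇒Odd-suc (mult k xs) ¬o)

  length-insert : ∀ k xs → length (insert k xs) ≡ suc (length xs)
  length-insert k xs = ↭-length (insert-↭ k xs)

  insert-injective : ∀ k {xs ys} → insert k xs ≡ insert k ys → xs ≡ ys
  insert-injective k {[]}     {[]}     _  = refl
  insert-injective k {[]}     {y ∷ ys} eq
    with () ← suc-injective (trans (cong length eq) (length-insert k (y ∷ ys)))
  insert-injective k {x ∷ xs} {[]}     eq
    with () ← suc-injective (trans (sym (length-insert k (x ∷ xs))) (cong length eq))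
  insert-injective k {x ∷ xs} {y ∷ ys} eq with x ≤ᵇ k in x≤k | y ≤ᵇ k in y≤k
  ... | true  | true  = ∷-injectiveʳ eq
  ... | true  | false = ⊥-elim (subst T y≤k (≤⇒≤ᵇ (≤-reflexive (sym (∷-injectiveˡ eq)))))
  ... | false | true  = ⊥-elim (subst T x≤k (≤⇒≤ᵇ (≤-reflexive (∷-injectiveˡ eq))))
  ... | false | false = cong₂ _∷_ (∷-injectiveˡ eq) (insert-injective k (∷-injectiveʳ eq))

  sorted-↭⇒≡ : ∀ {xs ys} → Linked _≥_ xs → Linked _≥_ ys → xs ↭ ys → xs ≡ ys
  sorted-↭⇒≡ xs↘ ys↘ xs↭ys =
    Pointwise-≡⇒≡ (↗↭↗⇒≋ (DecTotalOrder.totalOrder ≥-decTotalOrder) xs↘ ys↘ (↭⇒↭ₛ xs↭ys))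

  insert-surjective : ∀ {k xs} → Linked _≥_ xs → k ∈ xs →
                      ∃[ ys ] Linked _≥_ ys × xs ↭ k ∷ ys × insert k ys ≡ xs
  insert-surjective {k} xs↘ k∈xs with h , t , refl ← ∈-∃++ k∈xs =
    ys , sort-↗ (h ++ t) , xs↭kys ,
    sorted-↭⇒≡ (insert-↗ k (sort-↗ (h ++ t))) xs↘ (↭-trans (insert-↭ k ys) (↭-sym xs↭kys))
    where
    ys = sort (h ++ t)
    xs↭kys : h ++ [ k ] ++ t ↭ k ∷ ys
    xs↭kys = ↭-trans (shift k h t) (↭-prep k (↭-sym (sort-↭ (h ++ t))))

  -- π is a partition of N ∸ d into parts greater than n; the offset d keeps truncated
  -- subtraction out of the counting below.
  PartitionAbove : ℕ → ℕ → ℕ → List ℕ → Set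
  PartitionAbove n d N π = Linked _≥_ π × All (n <_) π × d + size π ≡ N

  insert-enumerates : ∀ {n d N k xs} → n < k → Enumerates (PartitionAbove n (d + k) N) xs →
                      Enumerates (λ π → PartitionAbove n d N π × k ∈ π) (map (insert k) xs)
  insert-enumerates {n} {d} {N} {k} n<k xs-enum =
    enumerates-resp (λ π → mk⇔ image⇒ image⇐) (enumerates-map (insert k) (insert-injective k) xs-enum)
    where
    Image : List ℕ → Set
    Image π = ∃[ σ ] PartitionAbove n (d + k) N σ × insert k σ ≡ π
    image⇒ : ∀ {π} → Image π → PartitionAbove n d N π × k ∈ π
    image⇒ (σ , (σ↘ , σ>n , d+k+|σ|≡N) , refl) =
      (insert-↗ k σ↘ , All-resp-↭ (↭-sym (insert-↭ k σ)) (n<k ∷ σ>n) ,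
       trans (cong (_+_ d) (sum-↭ (insert-↭ k σ))) (trans (sym (+-assoc d k (size σ))) d+k+|σ|≡N)) ,
      ∈-resp-↭ (↭-sym (insert-↭ k σ)) (here refl)
    image⇐ : ∀ {π} → PartitionAbove n d N π × k ∈ π → Image π
    image⇐ ((π↘ , π>n , d+|π|≡N) , k∈π) =
      let σ , σ↘ , π↭kσ , kσ≡π = insert-surjective π↘ k∈π in
      σ , (σ↘ , tail (All-resp-↭ π↭kσ π>n) ,
           trans (+-assoc d k (size σ)) (trans (cong (_+_ d) (sym (sum-↭ π↭kσ))) d+|π|≡N)) ,
      kσ≡π

  split-above : ∀ {n d N π} →
                ((PartitionAbove n d N π × suc n ∈ π) ⊎ PartitionAbove (suc n) d N π) ⇔ PartitionAbove n d N π
  split-above {n} {d} {N} {π} = mk⇔ (λ { (inj₁ (p , _)) → p ; (inj₂ p) → weaken p }) split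
    where
    weaken : PartitionAbove (suc n) d N π → PartitionAbove n d N π
    weaken (π↘ , π>1+n , eq) = π↘ , All-map <⇒≤ π>1+n , eq
    split : PartitionAbove n d N π → (PartitionAbove n d N π × suc n ∈ π) ⊎ PartitionAbove (suc n) d N π
    split p@(π↘ , π>n , eq) with suc n ∈? π
    ... | yes 1+n∈π = inj₁ (p , 1+n∈π)
    ... | no 1+n∉π  =
      inj₂ (π↘ , zipWith (λ (n<x , 1+n≢x) → ≤∧≢⇒< n<x 1+n≢x) (π>n , ¬Any⇒All¬ π 1+n∉π) , eq)

  split-enumerates : ∀ {n d N xs ys} →
                     Enumerates (PartitionAbove n (d + suc n) N) xs →
                     Enumerates (PartitionAbove (suc n) d N) ys →
                     Enumerates (PartitionAbove n d N) (map (insert (suc n)) xs ++ ys)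
  split-enumerates xs-enum ys-enum =
    enumerates-resp (λ _ → split-above)
      (enumerates-++ (insert-enumerates ≤-refl xs-enum) ys-enum
        (λ (_ , 1+n∈π) (_ , π>1+n , _) → <-irrefl refl (All-lookup π>1+n 1+n∈π)))

  no-parts-above : ∀ {n d N π} → N ≤ d + n → PartitionAbove n d N π → π ≡ []
  no-parts-above {π = []}     _ _ = refl
  no-parts-above {n} {d} {π = x ∷ xs} N≤d+n (_ , n<x ∷ _ , d+|π|≡N) = ⊥-elim (<-irrefl refl n<n)
    where
    |π|≤n : size (x ∷ xs) ≤ n
    |π|≤n = +-cancelˡ-≤ d _ n (subst (_≤ d + n) (sym d+|π|≡N) N≤d+n)
    n<n : n < n
    n<n = <-≤-trans n<x (≤-trans (m≤m+n x (size xs)) |π|≤n)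

  -- Fuel f suffices once N ≤ f + d + n: each call raises d + n by at least one.
  enumerate : ℕ → ℕ → ℕ → ℕ → List (List ℕ)
  enumerate zero n d N with d ≟ N
  ... | yes _ = [ [] ]
  ... | no _  = []
  enumerate (suc f) n d N = map (insert (suc n)) (enumerate f n (d + suc n) N) ++ enumerate f (suc n) d N

  enumerate-enumerates : ∀ f n d N → N ≤ f + (d + n) →
                         Enumerates (PartitionAbove n d N) (enumerate f n d N)
  enumerate-enumerates zero n d N N≤d+n with d ≟ N
  ... | yes refl = enumerates-[-] ([] , [] , +-identityʳ d) (no-parts-above {n} {d} N≤d+n)
  ... | no d≢N   = enumerates-[] λ π p@(_ , _ , d+|π|≡N) → d≢N (trans (sym (+-identityʳ d))
                     (subst (λ π → d + size π ≡ N) (no-parts-above {n} {d} N≤d+n p) d+|π|≡N))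
  enumerate-enumerates (suc f) n d N N≤ =
    split-enumerates (enumerate-enumerates f n (d + suc n) N (≤-trans N≤′ (+-monoʳ-≤ f (m≤m+n _ n))))
                     (enumerate-enumerates f (suc n) d N N≤′)
    where
    N≤′ : N ≤ f + (d + suc n)
    N≤′ = subst (N ≤_) (sym (trans (cong (_+_ f) (+-suc d n)) (+-suc f (d + n)))) N≤

  partitions : ℕ → ℕ → ℕ → List (List ℕ)
  partitions n d N = enumerate N n d N

  partitions-enumerates : ∀ n d N → Enumerates (PartitionAbove n d N) (partitions n d N)
  partitions-enumerates n d N = enumerate-enumerates N n d N (m≤m+n N (d + n))

  ≤-smallest : ∀ {k x xs} → All (k ≤_) (x ∷ xs) → k ≤ smallest (x ∷ xs)
  ≤-smallest {xs = []}     (k≤x ∷ [])   = k≤x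
  ≤-smallest {xs = y ∷ ys} (k≤x ∷ k≤ys) = ⊓-glb k≤x (≤-smallest k≤ys)

  smallest-≡ : ∀ {k xs} → k ∈ xs → All (k ≤_) xs → smallest xs ≡ k
  smallest-≡ {xs = _ ∷ []}    (here refl) _            = refl
  smallest-≡ {xs = _ ∷ _ ∷ _} (here refl) (_ ∷ k≤ys)   = m≤n⇒m⊓n≡m (≤-smallest k≤ys)
  smallest-≡ {xs = x ∷ _ ∷ _} (there k∈)  (k≤x ∷ k≤ys) =
    trans (cong (x ⊓_) (smallest-≡ k∈ k≤ys)) (m≥n⇒m⊓n≡n k≤x)

  smallest-insert : ∀ {k xs} → All (k ≤_) xs → smallest (insert k xs) ≡ k
  smallest-insert {k} {xs} k≤xs = smallest-≡ (∈-resp-↭ (↭-sym (insert-↭ k xs)) (here refl))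
                                             (All-resp-↭ (↭-sym (insert-↭ k xs)) (≤-refl ∷ k≤xs))

module AlternatingSums where

  open import Data.Nat using (zero; suc)
  open import Data.Integer using (0ℤ; _-_)
  open import Data.Integer.Solver using (module +-*-Solver)
  open import Relation.Binary.PropositionalEquality using (trans; cong₂)
  open +-*-Solver using (solve; _:=_; _:-_)

  alt : ℕ → (ℕ → ℤ) → ℤ
  alt zero    f = 0ℤ
  alt (suc m) f = f 0 - alt m (f ∘ suc)

  alt-cong : ∀ m {f g : ℕ → ℤ} → (∀ i → f i ≡ g i) → alt m f ≡ alt m g
  alt-cong zero    f≗g = refl
  alt-cong (suc m) f≗g = cong₂ _-_ (f≗g 0) (alt-cong m (f≗g ∘ suc))

  alt-zero : ∀ m {f : ℕ → ℤ} → (∀ i → f i ≡ 0ℤ) → alt m f ≡ 0ℤ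
  alt-zero zero    f≡0 = refl
  alt-zero (suc m) f≡0 = cong₂ _-_ (f≡0 0) (alt-zero m (f≡0 ∘ suc))

  alt-padʳ : ∀ m (f : ℕ → ℤ) → f m ≡ 0ℤ → alt (suc m) f ≡ alt m f
  alt-padʳ zero    f f0≡0 = cong (_- 0ℤ) f0≡0
  alt-padʳ (suc m) f fm≡0 = cong (f 0 -_) (alt-padʳ m (f ∘ suc) fm≡0)

  alt-sub : ∀ m (f g : ℕ → ℤ) → alt m f - alt m g ≡ alt m (λ i → f i - g i)
  alt-sub zero    f g = refl
  alt-sub (suc m) f g = trans (interchange (f 0) (alt m (f ∘ suc)) (g 0) (alt m (g ∘ suc)))
                              (cong (f 0 - g 0 -_) (alt-sub m (f ∘ suc) (g ∘ suc)))
    where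
    interchange : ∀ a b c e → (a - b) - (c - e) ≡ (a - c) - (b - e)
    interchange = solve 4 (λ a b c e → (a :- b) :- (c :- e) := (a :- c) :- (b :- e)) refl

module Counting (N : ℕ) where

  open import Data.Nat as ℕ using (zero; suc; _<_; z≤n; s≤s)
  import Data.Nat.Properties as ℕ
  open import Data.Nat.Solver using () renaming (module +-*-Solver to ℕ-Solver)
  open import Data.Integer using (0ℤ; 1ℤ; -1ℤ; _+_; _-_; _*_; _^_)
  import Data.Integer.Properties as ℤ
  open import Data.Integer.Solver using (module +-*-Solver)
  open import Algebra.Properties.AbelianGroup ℤ.+-0-abelianGroup using (∙-cancelʳ)
  open import Data.Empty using (⊥-elim)
  open import Data.List using (_++_)
  open import Data.List.Membership.DecPropositional ℕ._≟_ using (_∈?_)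
  open import Data.Product using (proj₂)
  open import Relation.Binary.PropositionalEquality using (trans; cong₂; subst)
  open ListSums
  open Enumerations
  open Partitions
  open AlternatingSums
  open ≡-Reasoning

  ∈-partitions⁻ : ∀ {n d π} → π ∈ partitions n d N → PartitionAbove n d N π
  ∈-partitions⁻ {n} {d} {π} = Equivalence.to (proj₂ (partitions-enumerates n d N) π)

  partitions-split : ∀ (w : List ℕ → ℤ) n d →
                     sumBy w (partitions n d N) ≡
                     sumBy (w ∘ insert (suc n)) (partitions n (d ℕ.+ suc n) N) + sumBy w (partitions (suc n) d N)
  partitions-split w n d = begin
    sumBy w (partitions n d N)                            ≡⟨ sumBy-↭ w (enumerates-↭ (partitions-enumerates n d N)
                                                               (split-enumerates (partitions-enumerates n e N)
                                                                                 (partitions-enumerates (suc n) d N))) ⟩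
    sumBy w (map (insert (suc n)) P ++ Q)                 ≡⟨ sumBy-++ w (map (insert (suc n)) P) Q ⟩
    sumBy w (map (insert (suc n)) P) + sumBy w Q          ≡⟨ cong (_+ sumBy w Q) (sumBy-map w (insert (suc n)) P) ⟩
    sumBy (w ∘ insert (suc n)) P + sumBy w Q              ∎
    where
    e = d ℕ.+ suc n
    P = partitions n e N
    Q = partitions (suc n) d N

  count : ℕ → ℕ → ℤ
  count n d = sumBy (λ _ → 1ℤ) (partitions n d N)

  count-beyond : ∀ n {d} → N < d → count n d ≡ 0ℤ
  count-beyond n {d} N<d = sumBy-zero _ λ π∈ →
    let _ , _ , d+|π|≡N = ∈-partitions⁻ π∈ in
    ⊥-elim (ℕ.<⇒≱ N<d (subst (d ℕ.≤_) d+|π|≡N (ℕ.m≤m+n d _)))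

  count-drop : ∀ n d → count n d - count (suc n) d ≡ count n (d ℕ.+ suc n)
  count-drop n d = begin
    count n d - count (suc n) d
      ≡⟨ cong (_- count (suc n) d) (partitions-split _ n d) ⟩
    count n (d ℕ.+ suc n) + count (suc n) d - count (suc n) d
      ≡⟨ +-minus (count n (d ℕ.+ suc n)) (count (suc n) d) ⟩
    count n (d ℕ.+ suc n)
      ∎
    where
    open +-*-Solver using (solve; _:=_; _:+_; _:-_)
    +-minus : ∀ a b → a + b - b ≡ a
    +-minus = solve 2 (λ a b → a :+ b :- b := a) refl

  -- Σ_{i ≤ N} (-1)^i q_{n+i}(N - d - i k); for k ≥ 1 the omitted terms i > N vanish.
  altCount : ℕ → ℕ → ℕ → ℤ
  altCount k n d = alt (suc N) (λ i → count (n ℕ.+ i) (d ℕ.+ i ℕ.* k))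

  altCount-step : ∀ k n d → altCount k n d - altCount k (suc n) d ≡ altCount (suc k) n (d ℕ.+ suc n)
  altCount-step k n d = begin
    altCount k n d - altCount k (suc n) d
      ≡⟨ alt-sub (suc N) (λ i → count (n ℕ.+ i) e[ i ]) (λ i → count (suc n ℕ.+ i) e[ i ]) ⟩
    alt (suc N) (λ i → count (n ℕ.+ i) e[ i ] - count (suc n ℕ.+ i) e[ i ])
      ≡⟨ alt-cong (suc N) termwise ⟩
    altCount (suc k) n (d ℕ.+ suc n)
      ∎
    where
    e[_] : ℕ → ℕ
    e[ i ] = d ℕ.+ i ℕ.* k
    open ℕ-Solver using (solve; _:=_; _:+_; _:*_; con)
    offset : ∀ d i k n → d ℕ.+ i ℕ.* k ℕ.+ suc (n ℕ.+ i) ≡ d ℕ.+ suc n ℕ.+ i ℕ.* suc k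
    offset = solve 4 (λ d i k n → d :+ i :* k :+ (con 1 :+ (n :+ i)) := d :+ (con 1 :+ n) :+ i :* (con 1 :+ k))
                     refl
    termwise : ∀ i → count (n ℕ.+ i) e[ i ] - count (suc n ℕ.+ i) e[ i ] ≡
                     count (n ℕ.+ i) (d ℕ.+ suc n ℕ.+ i ℕ.* suc k)
    termwise i = trans (count-drop (n ℕ.+ i) e[ i ]) (cong (count (n ℕ.+ i)) (offset d i k n))

  record RunRecurrence (X : ℕ → ℕ → ℤ) : Set where
    field
      step   : ∀ k d → X (suc k) d + X (suc k) (d ℕ.+ suc k) ≡
                       count 0 (d ℕ.+ suc k) + X (suc (suc k)) (d ℕ.+ suc k)
      beyond : ∀ k d → N < d ℕ.+ suc k → X (suc k) d ≡ 0ℤ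

  RunRecurrence-unique : ∀ {X Y} → RunRecurrence X → RunRecurrence Y → ∀ k d → X (suc k) d ≡ Y (suc k) d
  RunRecurrence-unique {X} {Y} X-rec Y-rec k d = go N k d (ℕ.m≤n+m N d)
    where
    open RunRecurrence X-rec renaming (step to X-step; beyond to X-beyond)
    open RunRecurrence Y-rec renaming (step to Y-step; beyond to Y-beyond)
    go : ∀ f k d → N ℕ.≤ d ℕ.+ f → X (suc k) d ≡ Y (suc k) d
    go zero    k d N≤d+0 = trans (X-beyond k d N<) (sym (Y-beyond k d N<))
      where
      N< : N < d ℕ.+ suc k
      N< = ℕ.≤-<-trans N≤d+0 (ℕ.+-monoʳ-< d (s≤s z≤n))
    go (suc f) k d N≤ = ∙-cancelʳ (X (suc k) e) (X (suc k) d) (Y (suc k) d) (begin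
      X (suc k) d + X (suc k) e          ≡⟨ X-step k d ⟩
      count 0 e + X (suc (suc k)) e      ≡⟨ cong (_+_ (count 0 e)) (go f (suc k) e N≤e+f) ⟩
      count 0 e + Y (suc (suc k)) e      ≡⟨ sym (Y-step k d) ⟩
      Y (suc k) d + Y (suc k) e          ≡⟨ cong (_+_ (Y (suc k) d)) (sym (go f k e N≤e+f)) ⟩
      Y (suc k) d + X (suc k) e          ∎)
      where
      e = d ℕ.+ suc k
      N≤e+f : N ℕ.≤ e ℕ.+ f
      N≤e+f = ℕ.≤-trans N≤ (subst (ℕ._≤ e ℕ.+ f) (ℕ.+-assoc d 1 f)
                                  (ℕ.+-monoˡ-≤ f (ℕ.+-monoʳ-≤ d (s≤s z≤n))))

  -- A_k(N - d)
  altRunSum : ℕ → ℕ → ℤ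
  altRunSum k d = altCount k 0 (d ℕ.+ k)

  altRunSum-recurrence : RunRecurrence altRunSum
  altRunSum-recurrence = record { step = step ; beyond = beyond }
    where
    beyond : ∀ k d → N < d ℕ.+ suc k → altRunSum (suc k) d ≡ 0ℤ
    beyond k d N<e = alt-zero (suc N) λ i → count-beyond i (ℕ.<-≤-trans N<e (ℕ.m≤m+n _ (i ℕ.* suc k)))
    step : ∀ k d → altRunSum (suc k) d + altRunSum (suc k) (d ℕ.+ suc k) ≡
                   count 0 (d ℕ.+ suc k) + altRunSum (suc (suc k)) (d ℕ.+ suc k)
    step k d = begin
      altRunSum K d + altRunSum K e
        ≡⟨ cong (λ x → count 0 x - alt N tail + altRunSum K e) (ℕ.+-identityʳ e) ⟩
      count 0 e - alt N tail + altCount K 0 (e ℕ.+ K)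
        ≡⟨ cong (λ x → count 0 e - x + altCount K 0 (e ℕ.+ K)) tail≡ ⟩
      count 0 e - altCount K 1 (e ℕ.+ K) + altCount K 0 (e ℕ.+ K)
        ≡⟨ swap-minus (count 0 e) (altCount K 1 (e ℕ.+ K)) (altCount K 0 (e ℕ.+ K)) ⟩
      count 0 e + (altCount K 0 (e ℕ.+ K) - altCount K 1 (e ℕ.+ K))
        ≡⟨ cong (_+_ (count 0 e)) (altCount-step K 0 (e ℕ.+ K)) ⟩
      count 0 e + altCount (suc K) 0 (e ℕ.+ K ℕ.+ 1)
        ≡⟨ cong (λ x → count 0 e + altCount (suc K) 0 x)
                (trans (ℕ.+-assoc e K 1) (cong (ℕ._+_ e) (ℕ.+-comm K 1))) ⟩
      count 0 e + altRunSum (suc K) e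
        ∎
      where
      K = suc k
      e = d ℕ.+ K
      tail : ℕ → ℤ
      tail i = count (suc i) (e ℕ.+ (K ℕ.+ i ℕ.* K))
      N<last : N < e ℕ.+ K ℕ.+ N ℕ.* K
      N<last = ℕ.<-≤-trans (s≤s (ℕ.m≤m*n N K))
                           (ℕ.+-monoˡ-≤ (N ℕ.* K) (ℕ.≤-trans (s≤s z≤n) (ℕ.m≤n+m K e)))
      tail≡ : alt N tail ≡ altCount K 1 (e ℕ.+ K)
      tail≡ = begin
        alt N tail
          ≡⟨ alt-cong N (λ i → cong (count (suc i)) (sym (ℕ.+-assoc e K (i ℕ.* K)))) ⟩
        alt N (λ i → count (suc i) (e ℕ.+ K ℕ.+ i ℕ.* K))
          ≡⟨ sym (alt-padʳ N _ (count-beyond (suc N) N<last)) ⟩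
        altCount K 1 (e ℕ.+ K)
          ∎
      open +-*-Solver using (solve; _:=_; _:+_; _:-_)
      swap-minus : ∀ a b c → a - b + c ≡ a + (c - b)
      swap-minus = solve 3 (λ a b c → a :- b :+ c := a :+ (c :- b)) refl

  runℤ : ℕ → List ℕ → ℤ
  runℤ k π = + run k π

  -- B_k(N - d)
  runSum : ℕ → ℕ → ℤ
  runSum k d = sumBy (runℤ k) (partitions 0 d N)

  runSum-insert : ∀ k d → runSum (suc k) d ≡ sumBy (runℤ (suc k) ∘ insert (suc k)) (partitions 0 (d ℕ.+ suc k) N)
  runSum-insert k d = begin
    sumBy (runℤ (suc k)) (partitions 0 d N)
      ≡⟨ sym (sumBy-filter (suc k ∈?_) (runℤ (suc k)) (partitions 0 d N) (cong +_ ∘ run-∉)) ⟩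
    sumBy (runℤ (suc k)) (filter (suc k ∈?_) (partitions 0 d N))
      ≡⟨ sumBy-↭ (runℤ (suc k)) (enumerates-↭ (enumerates-filter (suc k ∈?_) (partitions-enumerates 0 d N))
                                      (insert-enumerates (s≤s z≤n) (partitions-enumerates 0 e N))) ⟩
    sumBy (runℤ (suc k)) (map (insert (suc k)) (partitions 0 e N))
      ≡⟨ sumBy-map (runℤ (suc k)) (insert (suc k)) (partitions 0 e N) ⟩
    sumBy (runℤ (suc k) ∘ insert (suc k)) (partitions 0 e N)
      ∎
    where
    e = d ℕ.+ suc k

  runSum-recurrence : RunRecurrence runSum
  runSum-recurrence = record { step = step ; beyond = beyond }
    where
    beyond : ∀ k d → N < d ℕ.+ suc k → runSum (suc k) d ≡ 0ℤ
    beyond k d N<d+k = sumBy-zero _ λ π∈ → cong +_ (run-∉ λ k∈π →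
      let _ , _ , d+|π|≡N = ∈-partitions⁻ π∈ in
      ℕ.<⇒≱ N<d+k (subst (d ℕ.+ suc k ℕ.≤_) d+|π|≡N (ℕ.+-monoʳ-≤ d (∈⇒≤size k∈π))))
    step : ∀ k d → runSum (suc k) d + runSum (suc k) (d ℕ.+ suc k) ≡
                   count 0 (d ℕ.+ suc k) + runSum (suc (suc k)) (d ℕ.+ suc k)
    step k d = begin
      runSum K d + runSum K e                         ≡⟨ cong (_+ runSum K e) (runSum-insert k d) ⟩
      sumBy (runℤ K ∘ insert K) P + sumBy (runℤ K) P  ≡⟨ sym (sumBy-+ (runℤ K ∘ insert K) (runℤ K) P) ⟩
      sumBy (λ σ → runℤ K (insert K σ) + runℤ K σ) P  ≡⟨ sumBy-cong P (λ {σ} _ → run-insertℤ σ) ⟩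
      sumBy (λ σ → 1ℤ + runℤ (suc K) σ) P             ≡⟨ sumBy-+ (λ _ → 1ℤ) (runℤ (suc K)) P ⟩
      count 0 e + runSum (suc K) e                    ∎
      where
      K = suc k
      e = d ℕ.+ K
      P = partitions 0 e N
      run-insertℤ : ∀ σ → runℤ K (insert K σ) + runℤ K σ ≡ 1ℤ + runℤ (suc K) σ
      run-insertℤ σ = trans (sym (ℤ.pos-+ (run K (insert K σ)) (run K σ)))
                            (trans (cong +_ (run-insert K σ)) (ℤ.pos-+ 1 (run (suc K) σ)))

  sign-insert : ∀ n {σ} → σ ∈ partitions n (suc n) N → sign (insert (suc n) σ) ≡ -1ℤ ^ (suc n ℕ.+ 1)
  sign-insert n σ∈ = let _ , σ>n , _ = ∈-partitions⁻ σ∈ in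
    cong (λ s → -1ℤ ^ (s ℕ.+ 1)) (smallest-insert σ>n)

  -- Split off the partitions with smallest part n + 1, all of sign (-1)^n.
  sign-sum : 1 ℕ.≤ N → ∀ m n → N ℕ.≤ n ℕ.+ m →
             sumBy sign (partitions n 0 N) ≡ -1ℤ ^ (suc n ℕ.+ 1) * alt m (λ i → count (n ℕ.+ i) (suc (n ℕ.+ i)))
  sign-sum 1≤N zero n N≤n = trans (sumBy-zero sign λ π∈ → ⊥-elim (ℕ.<⇒≢ 1≤N (size≡N π∈)))
                                  (sym (ℤ.*-zeroʳ (-1ℤ ^ (suc n ℕ.+ 1))))
    where
    size≡N : ∀ {π} → π ∈ partitions n 0 N → 0 ≡ N
    size≡N {π} π∈ = let p@(_ , _ , |π|≡N) = ∈-partitions⁻ π∈ in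
      subst (λ π → size π ≡ N) (no-parts-above {n} {0} (subst (N ℕ.≤_) (ℕ.+-identityʳ n) N≤n) p) |π|≡N
  sign-sum 1≤N (suc m) n N≤ = begin
    sumBy sign (partitions n 0 N)
      ≡⟨ partitions-split sign n 0 ⟩
    sumBy (sign ∘ insert (suc n)) P + sumBy sign (partitions (suc n) 0 N)
      ≡⟨ cong₂ _+_ (trans (sumBy-cong P λ σ∈ → trans (sign-insert n σ∈) (sym (ℤ.*-identityʳ ε)))
                          (sumBy-*ˡ ε _ P))
                   (sign-sum 1≤N m (suc n) (subst (N ℕ.≤_) (ℕ.+-suc n m) N≤)) ⟩
    ε * count n (suc n) + -1ℤ * ε * alt m (λ i → count (suc n ℕ.+ i) (suc (suc n ℕ.+ i)))
      ≡⟨ factor ε (count n (suc n)) _ ⟩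
    ε * (count n (suc n) - alt m (λ i → count (suc n ℕ.+ i) (suc (suc n ℕ.+ i))))
      ≡⟨ cong (ε *_) (cong₂ _-_ (cong smallest-count (sym (ℕ.+-identityʳ n)))
                                (alt-cong m (λ i → cong smallest-count (sym (ℕ.+-suc n i))))) ⟩
    ε * alt (suc m) (λ i → count (n ℕ.+ i) (suc (n ℕ.+ i)))
      ∎
    where
    ε = -1ℤ ^ (suc n ℕ.+ 1)
    P = partitions n (suc n) N
    smallest-count : ℕ → ℤ
    smallest-count j = count j (suc j)
    open +-*-Solver using (solve; _:=_; _:+_; _:-_; _:*_; con)
    factor : ∀ s a b → s * a + -1ℤ * s * b ≡ s * (a - b)
    factor = solve 3 (λ s a b → s :* a :+ con -1ℤ :* s :* b := s :* (a :- b)) refl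

  sign-sum≡altRunSum : 1 ℕ.≤ N → sumBy sign (partitions 0 0 N) ≡ altRunSum 1 0
  sign-sum≡altRunSum 1≤N = begin
    sumBy sign (partitions 0 0 N)             ≡⟨ sign-sum 1≤N (suc N) 0 (ℕ.n≤1+n N) ⟩
    1ℤ * alt (suc N) (λ i → count i (suc i))  ≡⟨ ℤ.*-identityˡ _ ⟩
    alt (suc N) (λ i → count i (suc i))       ≡⟨ alt-cong (suc N) (λ i → cong (count i ∘ suc) (sym (ℕ.*-identityʳ i))) ⟩
    altRunSum 1 0                             ∎

open ListSums using (sumBy; sumBy-↭; sumBy-filter; pos-sum-map)
open Enumerations using (Enumerates; enumerates-↭)
open Partitions using (PartitionAbove; partitions; partitions-enumerates; run-even)

theorem3p1 : (N : ℕ) → 1 ≤ N →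
    (ps : List (List ℕ)) → Unique ps →
    ((π : List ℕ) → (π ∈ ps) ⇔ (IsPartition π × size π ≡ N)) →
    sumℤ (map sign ps) ≡ + sum (map t (filter (λ π → odd? (mult 1 π)) ps))
theorem3p1 N 1≤N ps ps-unique ps-spec = begin
  sumBy sign ps                        ≡⟨ sumBy-↭ sign (enumerates-↭ ps-enumerates (partitions-enumerates 0 0 N)) ⟩
  sumBy sign (partitions 0 0 N)        ≡⟨ sign-sum≡altRunSum 1≤N ⟩
  altRunSum 1 0                        ≡⟨ RunRecurrence-unique altRunSum-recurrence runSum-recurrence 0 0 ⟩
  runSum 1 0                           ≡⟨ sumBy-↭ (+_ ∘ t) (enumerates-↭ (partitions-enumerates 0 0 N) ps-enumerates) ⟩
  sumBy (+_ ∘ t) ps                    ≡⟨ sym (sumBy-filter odd-f₁? (+_ ∘ t) ps (cong +_ ∘ run-even 1 _)) ⟩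
  sumBy (+_ ∘ t) (filter odd-f₁? ps)   ≡⟨ sym (pos-sum-map t (filter odd-f₁? ps)) ⟩
  + sum (map t (filter odd-f₁? ps))    ∎
  where
  open ≡-Reasoning
  open Counting N
  odd-f₁? : (π : List ℕ) → Dec (Odd (mult 1 π))
  odd-f₁? π = odd? (mult 1 π)
  ps-enumerates : Enumerates (PartitionAbove 0 0 N) ps
  ps-enumerates = ps-unique , λ π → mk⇔
    (λ π∈ → let (π↘ , π>0 , _) , |π|≡N = Equivalence.to (ps-spec π) π∈ in π↘ , π>0 , |π|≡N)
    (λ (π↘ , π>0 , |π|≡N) →
       Equivalence.from (ps-spec π) ((π↘ , π>0 , λ { refl → <⇒≢ 1≤N |π|≡N }) , |π|≡N))
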